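{- Let $\mathbb{I}$ be an interval and let $\pi\colon\Lambda\to\mathbb{I}$ be the projection $(j\sqsupseteq i)\mapsto j$. For each $j:\mathbb{I}$, the fibre of $\pi$ over $j$ is equivalent to the Sierpiński cone $[\![j]\!]_\bot$ of the proposition $[\![j]\!]$: the square with top $[\![j]\!]_\bot\to\Lambda$ sending an element with first component $i$ (so $i=0\lor j=1$) to $(j\sqsupseteq i)$, left $[\![j]\!]_\bot\to\{j\}$, right $\pi$ and bottom $\{j\}\hookrightarrow\mathbb{I}$ is a pullback. Hence $\Lambda\simeq\sum_{j:\mathbb{I}}[\![j]\!]_\bot$.
   Context: Homotopy type theory. An interval is a set $\mathbb{I}$ with bounded meet-semilattice structure $(0,1,\sqcap)$, $i\sqsubseteq j$ meaning $i\sqcap j=i$; $[\![i]\!]:\equiv(i=1)$. $\Delta^2:\equiv\{(j,i)\mid j\sqsupseteq i\}$, written $(j\sqsupseteq i)$; the horn is $\Lambda:\equiv\{(j\sqsupseteq i)\in\Delta^2\mid i=0\lor j=1\}$. The join $P*X$ of types is the pushout of $P\leftarrow P\times X\to X$ (for propositions, the disjunction). The Sierpiński cone of a type $X$ is $X_\bot:\equiv\sum_{i:\mathbb{I}}(i=0)*X$; in particular $[\![j]\!]_\bot\simeq\sum_{i:\mathbb{I}}(i=0\lor j=1)$. (When $\mathbb{I}$ has binary joins, $\pi$ is $(j\sqsupseteq i)\mapsto i\sqcup j$.) -}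

module Defs where

open import Level using (Level; _⊔_; Setω) renaming (suc to lsuc)
open import Data.Product using (Σ; _×_; _,_; proj₁; proj₂)
open import Data.Sum using (_⊎_; inj₁; inj₂)
open import Relation.Binary.PropositionalEquality using (_≡_; refl; subst; sym; trans)

isProp : ∀ {a} → Set a → Set a
isProp A = (x y : A) → x ≡ y

isSet : ∀ {a} → Set a → Set a
isSet A = (x y : A) → isProp (x ≡ y)

isEquiv : ∀ {a b} {A : Set a} {B : Set b} → (A → B) → Set (a ⊔ b)
isEquiv {A = A} {B} f =
  (Σ (B → A) λ g → (x : A) → g (f x) ≡ x) × (Σ (B → A) λ h → (y : B) → f (h y) ≡ y)

_≃_ : ∀ {a b} → Set a → Set b → Set (a ⊔ b)
A ≃ B = Σ (A → B) isEquiv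

-- Propositional truncation, assumed as an abstract structure with its
-- universal property (Agda without cubical features has no HITs).
record PropTrunc : Setω where
  field
    ∥_∥ : ∀ {a} → Set a → Set a
    ∣_∣ : ∀ {a} {A : Set a} → A → ∥ A ∥
    ∥∥-isProp : ∀ {a} {A : Set a} → isProp ∥ A ∥
    ∥∥-rec : ∀ {a b} {A : Set a} {B : Set b} → isProp B → (A → B) → ∥ A ∥ → B

record Interval (ℓ : Level) : Set (lsuc ℓ) where
  field
    𝕀 : Set ℓ
    𝕀-isSet : isSet 𝕀
    𝟘 𝟙 : 𝕀
    _⊓_ : 𝕀 → 𝕀 → 𝕀
    ⊓-assoc : ∀ x y z → (x ⊓ y) ⊓ z ≡ x ⊓ (y ⊓ z)
    ⊓-comm  : ∀ x y → x ⊓ y ≡ y ⊓ x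
    ⊓-idem  : ∀ x → x ⊓ x ≡ x
    ⊓-top   : ∀ x → x ⊓ 𝟙 ≡ x
    ⊓-bot   : ∀ x → 𝟘 ⊓ x ≡ 𝟘

module Horn {ℓ : Level} (T : PropTrunc) (I : Interval ℓ) where
  open PropTrunc T
  open Interval I

  _∨_ : ∀ {a b} → Set a → Set b → Set (a ⊔ b)
  P ∨ Q = ∥ P ⊎ Q ∥

  _⊑_ : 𝕀 → 𝕀 → Set ℓ
  i ⊑ j = i ⊓ j ≡ i

  ⟦_⟧ : 𝕀 → Set ℓ
  ⟦ j ⟧ = j ≡ 𝟙

  Δ² : Set ℓ
  Δ² = Σ (𝕀 × 𝕀) λ ji → proj₂ ji ⊑ proj₁ ji

  Λ : Set ℓ
  Λ = Σ Δ² λ x → (proj₂ (proj₁ x) ≡ 𝟘) ∨ (proj₁ (proj₁ x) ≡ 𝟙)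

  π : Λ → 𝕀
  π x = proj₁ (proj₁ (proj₁ x))

  -- Sierpiński cone of the proposition ⟦ j ⟧ :  Σ_{i:𝕀} (i = 0) * ⟦ j ⟧
  Cone : 𝕀 → Set ℓ
  Cone j = Σ 𝕀 λ i → (i ≡ 𝟘) ∨ ⟦ j ⟧

  Sing : 𝕀 → Set ℓ
  Sing j = Σ 𝕀 λ k → k ≡ j

  incl : ∀ {j} → Sing j → 𝕀
  incl = proj₁

  private
    ⊑-isProp : ∀ i j → isProp (i ⊑ j)
    ⊑-isProp i j = 𝕀-isSet (i ⊓ j) i

    fromEq : ∀ i j → (i ≡ 𝟘) ⊎ (j ≡ 𝟙) → i ⊑ j
    fromEq i j (inj₁ refl) = ⊓-bot j
    fromEq i j (inj₂ refl) = ⊓-top i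

  horn⇒⊑ : ∀ i j → (i ≡ 𝟘) ∨ (j ≡ 𝟙) → i ⊑ j
  horn⇒⊑ i j = ∥∥-rec (⊑-isProp i j) (fromEq i j)

  top : (j : 𝕀) → Cone j → Λ
  top j (i , h) = ((j , i) , horn⇒⊑ i j h) , h

  left : (j : 𝕀) → Cone j → Sing j
  left j _ = j , refl

  Pullback : 𝕀 → Set ℓ
  Pullback j = Σ Λ λ x → Σ (Sing j) λ s → π x ≡ incl s

  gap : (j : 𝕀) → Cone j → Pullback j
  gap j c = top j c , left j c , refl

  IsPullbackSquare : 𝕀 → Set ℓ
  IsPullbackSquare j = isEquiv (gap j)

{-# OPTIONS --safe #-}
module Submission where

open import Defs
open import Level using (Level)
open import Data.Product using (Σ; _×_; _,_; uncurry)
open import Relation.Binary.PropositionalEquality using (_≡_; refl; subst; cong; trans)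

-- The condition j ⊒ i defining Δ² is a proposition (𝕀 is a set) implied by
-- i = 0 ∨ j = 1, so an element of Λ is determined by a pair (j, i) with
-- i = 0 ∨ j = 1; fixing j leaves exactly the Sierpiński cone of ⟦ j ⟧.

inverse⇒isEquiv : ∀ {a b} {A : Set a} {B : Set b} {f : A → B} (g : B → A) →
                  (∀ x → g (f x) ≡ x) → (∀ y → f (g y) ≡ y) → isEquiv f
inverse⇒isEquiv g g∘f f∘g = (g , g∘f) , (g , f∘g)

module HornFibres {ℓ : Level} (T : PropTrunc) (I : Interval ℓ) where
  open PropTrunc T
  open Interval I
  open Horn T I

  ⊑-isProp : ∀ {i j} → isProp (i ⊑ j)
  ⊑-isProp = 𝕀-isSet _ _

  coneOf : (x : Λ) → Cone (π x)
  coneOf (((_ , i) , _) , h) = i , h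

  top-coneOf : (x : Λ) → top (π x) (coneOf x) ≡ x
  top-coneOf (((j , i) , p) , h) = cong (λ p′ → ((j , i) , p′) , h) (⊑-isProp _ p)

  gap⁻¹ : (j : 𝕀) → Pullback j → Cone j
  gap⁻¹ j (x , (k , k≡j) , πx≡k) = subst Cone (trans πx≡k k≡j) (coneOf x)

  gap-gap⁻¹ : (j : 𝕀) (y : Pullback j) → gap j (gap⁻¹ j y) ≡ y
  gap-gap⁻¹ j ((((.j , i) , p) , h) , (.j , refl) , refl) =
    cong (λ p′ → (((j , i) , p′) , h) , (j , refl) , refl) (⊑-isProp _ p)

  isPullbackSquare : (j : 𝕀) → IsPullbackSquare j
  isPullbackSquare j = inverse⇒isEquiv {f = gap j} (gap⁻¹ j) (λ _ → refl) (gap-gap⁻¹ j)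

  Λ≃ΣCone : Λ ≃ Σ 𝕀 Cone
  Λ≃ΣCone = (λ x → π x , coneOf x) , inverse⇒isEquiv (uncurry top) top-coneOf (λ _ → refl)

mainTheorem17 : {ℓ : Level} (T : PropTrunc) (I : Interval ℓ)
    → ((j : Interval.𝕀 I) → Horn.IsPullbackSquare T I j)
    × (Horn.Λ T I ≃ Σ (Interval.𝕀 I) (Horn.Cone T I))
mainTheorem17 T I = isPullbackSquare , Λ≃ΣCone
  where open HornFibres T I
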